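{- For every integer $k\ge 2$, the Mirrored-Binomial graph $MB_k$ (on $2^k$ vertices) is a series-parallel graph.
   Context: A multigraph is series-parallel (SP) if it can be obtained from $K_2$ (a single edge between two vertices called the terminals $s$ and $t$) by a finite sequence of operations, each being either a series extension (replace an edge $\{x,y\}$ by a new vertex $z$ and edges $\{x,z\},\{z,y\}$) or a parallel extension (add a new edge parallel to an existing edge $\{x,y\}$); a simple graph is SP if it is the result of such a sequence containing no multiple edges at the end. The graphs $MB_k$, each with two distinguished vertices $s,t$, are defined recursively: $MB_2$ is the path $s-a-b-t$ on four vertices. For $k\ge 3$, take two disjoint copies $C_1, C_2$ of $MB_{k-1}$, with distinguished vertices $s_1,t_1$ in $C_1$ and $s_2,t_2$ in $C_2$, and add the two edges $\{s_1,s_2\}$ and $\{t_1,t_2\}$; in the resulting graph $MB_k$ set $s=s_2$, $t=t_1$ (and $s'=s_1$, $t'=t_2$). (Equivalently, $MB_k$ consists of two binomial trees of dimension $k-1$, rooted at $s$ and $t$, with each non-root leaf of one tree joined to the corresponding leaf of the mirrored other tree.) -}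

module Defs where

open import Level using (0ℓ)
open import Data.Nat using (ℕ; zero; suc)
open import Data.Fin using (Fin; zero; suc; inject₁; fromℕ)
open import Data.Product using (_×_; _,_; Σ; ∃; ∃-syntax)
open import Data.Sum using (_⊎_; inj₁; inj₂)
open import Data.List using (List; []; _∷_; map)
open import Data.List.Membership.Propositional using (_∈_)
open import Data.List.Relation.Binary.Permutation.Propositional using (_↭_)
open import Data.List.Relation.Unary.AllPairs using (AllPairs)
open import Relation.Binary.PropositionalEquality using (_≡_)
open import Relation.Nullary using (¬_)
open import Function.Bundles using (_↔_; Inverse; _⇔_)

-- Multigraphs on the vertex set Fin n, given by a list of edges.
-- An edge is an ordered pair (x , y) read as the unordered pair {x,y};
-- the list may contain repetitions (multiple edges).

Edge : ℕ → Set
Edge n = Fin n × Fin n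

-- The edge to be extended is brought to the head of the
-- list by a permutation (edge lists are multisets), and its endpoints
-- may be swapped (edges are unordered).
data SPMulti : (n : ℕ) → List (Edge n) → Set where
  K₂       : SPMulti 2 ((zero , suc zero) ∷ [])
  perm     : ∀ {n es es'} → SPMulti n es → es ↭ es' → SPMulti n es'
  flip     : ∀ {n x y es} → SPMulti n ((x , y) ∷ es) → SPMulti n ((y , x) ∷ es)
  series   : ∀ {n x y es} → SPMulti n ((x , y) ∷ es) →
             SPMulti (suc n) ((inject₁ x , fromℕ n) ∷ (fromℕ n , inject₁ y)
                              ∷ map (λ e → inject₁ (Data.Product.proj₁ e) , inject₁ (Data.Product.proj₂ e)) es)
  parallel : ∀ {n e es} → SPMulti n (e ∷ es) → SPMulti n (e ∷ e ∷ es)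

SameEdge : ∀ {n} → Edge n → Edge n → Set
SameEdge (a , b) (c , d) = (a ≡ c × b ≡ d) ⊎ (a ≡ d × b ≡ c)

NoMultiEdges : ∀ {n} → List (Edge n) → Set
NoMultiEdges = AllPairs (λ e e' → ¬ SameEdge e e')

IsSeriesParallel : (V : Set) → (V → V → Set) → Set
IsSeriesParallel V Adj =
  Σ ℕ λ n → Σ (Fin n ↔ V) λ σ → Σ (List (Edge n)) λ es →
    SPMulti n es × NoMultiEdges es ×
    (∀ u v → Adj (Inverse.to σ u) (Inverse.to σ v) ⇔ ((u , v) ∈ es ⊎ (v , u) ∈ es))

-- Mirrored-Binomial graphs.  MBV m, MBEdge m describe MB_{m+2}.

MBV : ℕ → Set
MBV zero    = Fin 4
MBV (suc m) = MBV m ⊎ MBV m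

MBs MBt : (m : ℕ) → MBV m
MBs zero    = zero
MBs (suc m) = inj₂ (MBs m)
MBt zero    = suc (suc (suc zero))
MBt (suc m) = inj₁ (MBt m)

-- edges (one orientation); copy C₁ is inj₁, copy C₂ is inj₂
data MBEdge : (m : ℕ) → MBV m → MBV m → Set where
  sa   : MBEdge zero zero (suc zero)
  ab   : MBEdge zero (suc zero) (suc (suc zero))
  bt   : MBEdge zero (suc (suc zero)) (suc (suc (suc zero)))
  left : ∀ {m x y} → MBEdge m x y → MBEdge (suc m) (inj₁ x) (inj₁ y)
  right : ∀ {m x y} → MBEdge m x y → MBEdge (suc m) (inj₂ x) (inj₂ y)
  ss   : ∀ {m} → MBEdge (suc m) (inj₁ (MBs m)) (inj₂ (MBs m))
  tt   : ∀ {m} → MBEdge (suc m) (inj₁ (MBt m)) (inj₂ (MBt m))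

MBAdj : (m : ℕ) → MBV m → MBV m → Set
MBAdj m x y = MBEdge m x y ⊎ MBEdge m y x

-- MB_k is an edge gadget: in any series-parallel derivation, an edge xy may be replaced by a copy of
-- MB_k with terminals s = x and t = y. For MB_2 subdivide xy twice. For MB_{k+1} double xy, subdivide
-- the copies into x–z–y and x–w–y, then replace xz by a copy C₂ of MB_k with terminals x, z and wy by a
-- copy C₁ with terminals w, y; the leftover edges xw and zy are exactly {s₂,s₁} and {t₂,t₁}.
-- Replacing the single edge of K₂ gives MB_k itself, which has no multiple edges.
module Submission where

open import Defs
open import Data.Nat using (ℕ; zero; suc; _≤_; _∸_; s≤s; z≤n)
open import Data.Fin using (Fin; zero; suc; inject₁; fromℕ)
open import Data.Maybe using (Maybe; just; nothing)
import Data.Maybe as Maybe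
open import Data.Product using (_×_; _,_)
import Data.Product as Product
open import Data.Sum using (_⊎_; inj₁; inj₂; map₁; [_,_])
import Data.Sum as Sum
open import Data.Sum.Properties using (inj₁-injective; inj₂-injective)
open import Data.Sum.Function.Propositional using (_⊎-⇔_)
open import Data.List using (List; []; _∷_; map; _++_)
open import Data.List.Properties using (map-id; map-∘; map-cong; map-++; ++-assoc; ++-identityʳ)
open import Data.List.Membership.Propositional using (_∈_)
open import Data.List.Membership.Propositional.Properties using (∈-map⁺; ∈-map⁻; ∈-++⁺ˡ; ∈-++⁺ʳ; ∈-++⁻)
open import Data.List.Relation.Unary.Any using (here; there)
open import Data.List.Relation.Unary.All using (All; []; _∷_; universal)
import Data.List.Relation.Unary.All.Properties as All
open import Data.List.Relation.Unary.AllPairs using (AllPairs; []; _∷_)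
import Data.List.Relation.Unary.AllPairs as AllPairs
import Data.List.Relation.Unary.AllPairs.Properties as AllPairs
open import Data.List.Relation.Binary.Permutation.Propositional using (_↭_; swap; ↭-refl; ↭-trans)
import Data.List.Relation.Binary.Permutation.Propositional.Properties as Perm
open import Function.Base using (_∘_)
open import Function.Bundles using (_↔_; Inverse; Injection; _⇔_; mk↔ₛ′; mk⇔)
open import Function.Properties.Inverse using (↔⇒↣)
open import Function.Construct.Composition using (_↔-∘_; _⇔-∘_)
open import Function.Construct.Identity using (↔-id)
open import Function.Construct.Symmetry using (↔-sym)
open import Relation.Binary.PropositionalEquality using (_≡_; refl; sym; trans; cong; cong₂; subst; module ≡-Reasoning)
open import Relation.Nullary using (¬_)

private variable
  A B C V : Set

Edges : Set → Set
Edges V = List (V × V)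

mapEdge : (A → B) → A × A → B × B
mapEdge f (a , b) = f a , f b

map-mapEdge-cong : {f g : A → B} → (∀ a → f a ≡ g a) → ∀ es → map (mapEdge f) es ≡ map (mapEdge g) es
map-mapEdge-cong f≗g = map-cong λ (a , b) → cong₂ _,_ (f≗g a) (f≗g b)

map-mapEdge-∘ : {f : B → C} {g : A → B} {h : A → C} → (∀ a → f (g a) ≡ h a) →
                ∀ es → map (mapEdge f) (map (mapEdge g) es) ≡ map (mapEdge h) es
map-mapEdge-∘ f∘g≗h es = trans (sym (map-∘ es)) (map-mapEdge-cong f∘g≗h es)

-- SPMulti over an arbitrary vertex type, closed under relabelling by bijections: this lets MB_k be
-- built with structurally named vertices rather than Fin indices.
data SP : (V : Set) → Edges V → Set₁ where
  K₂       : SP (Fin 2) ((zero , suc zero) ∷ [])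
  perm     : ∀ {V es es'} → SP V es → es ↭ es' → SP V es'
  series   : ∀ {V x y es} → SP V ((x , y) ∷ es) →
             SP (Maybe V) ((just x , nothing) ∷ (nothing , just y) ∷ map (mapEdge just) es)
  parallel : ∀ {V e es} → SP V (e ∷ es) → SP V (e ∷ e ∷ es)
  relabel  : ∀ {V W es} (σ : V ↔ W) → SP V es → SP W (map (mapEdge (Inverse.to σ)) es)

Maybe-↔ : A ↔ B → Maybe A ↔ Maybe B
Maybe-↔ σ = mk↔ₛ′ (Maybe.map to) (Maybe.map from) map-to-from map-from-to
  where
  open Inverse σ
  map-to-from : ∀ y → Maybe.map to (Maybe.map from y) ≡ y
  map-to-from (just y) = cong just (strictlyInverseˡ y)
  map-to-from nothing  = refl
  map-from-to : ∀ x → Maybe.map from (Maybe.map to x) ≡ x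
  map-from-to (just x) = cong just (strictlyInverseʳ x)
  map-from-to nothing  = refl

-- Sends fromℕ n, the vertex added by a series extension in SPMulti, to nothing.
Fin-suc↔Maybe : ∀ {n} → Fin (suc n) ↔ Maybe (Fin n)
Fin-suc↔Maybe = mk↔ₛ′ toMaybe fromMaybe toMaybe-fromMaybe fromMaybe-toMaybe
  where
  fromMaybe : ∀ {n} → Maybe (Fin n) → Fin (suc n)
  fromMaybe (just i)    = inject₁ i
  fromMaybe {n} nothing = fromℕ n

  toMaybe : ∀ {n} → Fin (suc n) → Maybe (Fin n)
  toMaybe {zero}  zero    = nothing
  toMaybe {suc n} zero    = just zero
  toMaybe {suc n} (suc i) = Maybe.map suc (toMaybe i)

  toMaybe-fromMaybe : ∀ {n} (j : Maybe (Fin n)) → toMaybe (fromMaybe j) ≡ j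
  toMaybe-fromMaybe {suc n} (just zero)    = refl
  toMaybe-fromMaybe {suc n} (just (suc i)) = cong (Maybe.map suc) (toMaybe-fromMaybe (just i))
  toMaybe-fromMaybe {zero}  nothing        = refl
  toMaybe-fromMaybe {suc n} nothing        = cong (Maybe.map suc) (toMaybe-fromMaybe {n} nothing)

  fromMaybe-map-suc : ∀ {n} (j : Maybe (Fin n)) → fromMaybe (Maybe.map suc j) ≡ suc (fromMaybe j)
  fromMaybe-map-suc (just i) = refl
  fromMaybe-map-suc nothing  = refl

  fromMaybe-toMaybe : ∀ {n} (i : Fin (suc n)) → fromMaybe (toMaybe i) ≡ i
  fromMaybe-toMaybe {zero}  zero    = refl
  fromMaybe-toMaybe {suc n} zero    = refl
  fromMaybe-toMaybe {suc n} (suc i) = trans (fromMaybe-map-suc (toMaybe i)) (cong suc (fromMaybe-toMaybe i))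

record FinRealisation (V : Set) (es : Edges V) : Set where
  field
    size       : ℕ
    vertices   : Fin size ↔ V
    derivation : SPMulti size (map (mapEdge (Inverse.from vertices)) es)

realise : ∀ {V es} → SP V es → FinRealisation V es
realise K₂ = record { size = 2 ; vertices = ↔-id _ ; derivation = K₂ }
realise (perm d p) = record { size = size ; vertices = vertices ; derivation = perm derivation (Perm.map⁺ _ p) }
  where open FinRealisation (realise d)
realise (parallel d) = record { size = size ; vertices = vertices ; derivation = parallel derivation }
  where open FinRealisation (realise d)
realise (series {x = x} {y} {es} d) = record
  { size       = suc size
  ; vertices   = Maybe-↔ vertices ↔-∘ Fin-suc↔Maybe
  ; derivation = subst (λ tail → SPMulti (suc size) ((inject₁ (from x) , fromℕ size) ∷ (fromℕ size , inject₁ (from y)) ∷ tail))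
                       (trans (map-mapEdge-∘ (λ _ → refl) es) (sym (map-mapEdge-∘ (λ _ → refl) es)))
                       (series derivation)
  }
  where open FinRealisation (realise d)
        open Inverse vertices using (from)
realise (relabel {es = es} σ d) = record
  { size       = size
  ; vertices   = σ ↔-∘ vertices
  ; derivation = subst (SPMulti size)
                       (sym (map-mapEdge-∘ (λ v → cong (Inverse.from vertices) (Inverse.strictlyInverseʳ σ v)) es))
                       derivation
  }
  where open FinRealisation (realise d)

Parallel : V × V → V × V → Set
Parallel (a , b) (c , d) = (a ≡ c × b ≡ d) ⊎ (a ≡ d × b ≡ c)

Simple : Edges V → Set
Simple = AllPairs (λ e e' → ¬ Parallel e e')

Simple-map : {f : A → B} → (∀ {a b} → f a ≡ f b → a ≡ b) → ∀ {es} → Simple es → Simple (map (mapEdge f) es)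
Simple-map f-injective =
  AllPairs.map⁺ ∘ AllPairs.map λ ¬e∥e' → ¬e∥e' ∘ Sum.map (Product.map f-injective f-injective)
                                                          (Product.map f-injective f-injective)

edge-↔ : A ↔ B → (A × A) ↔ (B × B)
edge-↔ σ = mk↔ₛ′ (mapEdge to) (mapEdge from)
  (λ (a , b) → cong₂ _,_ (strictlyInverseˡ a) (strictlyInverseˡ b))
  (λ (a , b) → cong₂ _,_ (strictlyInverseʳ a) (strictlyInverseʳ b))
  where open Inverse σ

∈⇔∈-map-from : (σ : A ↔ B) {x : A} {ys : List B} → Inverse.to σ x ∈ ys ⇔ x ∈ map (Inverse.from σ) ys
∈⇔∈-map-from σ {x} {ys} = mk⇔ to∈ from∈
  where
  open Inverse σ
  to∈ : to x ∈ ys → x ∈ map from ys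
  to∈ p = subst (_∈ map from ys) (strictlyInverseʳ x) (∈-map⁺ from p)
  from∈ : x ∈ map from ys → to x ∈ ys
  from∈ p with ∈-map⁻ from p
  ... | y , y∈ys , refl = subst (_∈ ys) (sym (strictlyInverseˡ y)) y∈ys

isSeriesParallel : ∀ {V es} {Adj : V → V → Set} → SP V es → Simple es →
                   (∀ u v → Adj u v ⇔ ((u , v) ∈ es ⊎ (v , u) ∈ es)) → IsSeriesParallel V Adj
isSeriesParallel {es = es} d simple adjacency =
  size , vertices , map (mapEdge from) es , derivation ,
  Simple-map (Injection.injective (↔⇒↣ (↔-sym vertices))) simple ,
  λ u v → (∈⇔∈-map-from (edge-↔ vertices) ⊎-⇔ ∈⇔∈-map-from (edge-↔ vertices)) ⇔-∘ adjacency (to u) (to v)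
  where
  open FinRealisation (realise d)
  open Inverse vertices

-- The bridging edges are oriented from C₂ to C₁, as the series-parallel construction produces them.
mbEdges : (m : ℕ) → Edges (MBV m)
mbEdges zero    = (zero , suc zero) ∷ (suc zero , suc (suc zero)) ∷ (suc (suc zero) , suc (suc (suc zero))) ∷ []
mbEdges (suc m) = map (mapEdge inj₁) (mbEdges m)
               ++ (inj₂ (MBs m) , inj₁ (MBs m)) ∷ (inj₂ (MBt m) , inj₁ (MBt m)) ∷ map (mapEdge inj₂) (mbEdges m)

mbEdges-sound : ∀ m {a b} → (a , b) ∈ mbEdges m → MBAdj m a b
mbEdges-sound zero (here refl)                 = inj₁ sa
mbEdges-sound zero (there (here refl))         = inj₁ ab
mbEdges-sound zero (there (there (here refl))) = inj₁ bt
mbEdges-sound (suc m) p with ∈-++⁻ (map (mapEdge inj₁) (mbEdges m)) p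
... | inj₁ p₁ with ∈-map⁻ (mapEdge inj₁) p₁
...   | _ , e∈ , refl = Sum.map left left (mbEdges-sound m e∈)
mbEdges-sound (suc m) p | inj₂ (here refl)         = inj₂ ss
mbEdges-sound (suc m) p | inj₂ (there (here refl)) = inj₂ tt
mbEdges-sound (suc m) p | inj₂ (there (there p₂)) with ∈-map⁻ (mapEdge inj₂) p₂
...   | _ , e∈ , refl = Sum.map right right (mbEdges-sound m e∈)

mbEdges-complete : ∀ m {a b} → MBEdge m a b → (a , b) ∈ mbEdges m ⊎ (b , a) ∈ mbEdges m
mbEdges-complete zero sa = inj₁ (here refl)
mbEdges-complete zero ab = inj₁ (there (here refl))
mbEdges-complete zero bt = inj₁ (there (there (here refl)))
mbEdges-complete (suc m) (left e)  = Sum.map in₁ in₁ (mbEdges-complete m e)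
  where
  in₁ : ∀ {a b} → (a , b) ∈ mbEdges m → (inj₁ a , inj₁ b) ∈ mbEdges (suc m)
  in₁ p = ∈-++⁺ˡ (∈-map⁺ (mapEdge inj₁) p)
mbEdges-complete (suc m) (right e) = Sum.map in₂ in₂ (mbEdges-complete m e)
  where
  in₂ : ∀ {a b} → (a , b) ∈ mbEdges m → (inj₂ a , inj₂ b) ∈ mbEdges (suc m)
  in₂ p = ∈-++⁺ʳ (map (mapEdge inj₁) (mbEdges m)) (there (there (∈-map⁺ (mapEdge inj₂) p)))
mbEdges-complete (suc m) ss = inj₂ (∈-++⁺ʳ (map (mapEdge inj₁) (mbEdges m)) (here refl))
mbEdges-complete (suc m) tt = inj₂ (∈-++⁺ʳ (map (mapEdge inj₁) (mbEdges m)) (there (here refl)))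

MBAdj⇔mbEdges : ∀ m a b → MBAdj m a b ⇔ ((a , b) ∈ mbEdges m ⊎ (b , a) ∈ mbEdges m)
MBAdj⇔mbEdges m a b = mk⇔
  [ mbEdges-complete m , Sum.swap ∘ mbEdges-complete m ]
  [ mbEdges-sound m , Sum.swap ∘ mbEdges-sound m ]

∦-by-source : {a b c d : V} → ¬ a ≡ c → ¬ a ≡ d → ¬ Parallel (a , b) (c , d)
∦-by-source a≢c _ (inj₁ (a≡c , _)) = a≢c a≡c
∦-by-source _ a≢d (inj₂ (a≡d , _)) = a≢d a≡d

inj₁∦inj₂ : (e : A × A) (e' : B × B) → ¬ Parallel (mapEdge inj₁ e) (mapEdge inj₂ e')
inj₁∦inj₂ _ _ (inj₁ (() , _))
inj₁∦inj₂ _ _ (inj₂ (() , _))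

inj₁∦bridge : (e : A × A) {c : B} {d : A} → ¬ Parallel (mapEdge inj₁ e) (inj₂ c , inj₁ d)
inj₁∦bridge _ (inj₁ (() , _))
inj₁∦bridge _ (inj₂ (_ , ()))

bridge∦inj₂ : {a : B} {b : A} (e : B × B) → ¬ Parallel (inj₂ a , inj₁ b) (mapEdge inj₂ e)
bridge∦inj₂ _ (inj₁ (_ , ()))
bridge∦inj₂ _ (inj₂ (_ , ()))

MBs≢MBt : ∀ m → ¬ MBs m ≡ MBt m
MBs≢MBt zero    ()
MBs≢MBt (suc m) ()

mbEdges-simple : ∀ m → Simple (mbEdges m)
mbEdges-simple zero =
  (∦-by-source (λ ()) (λ ()) ∷ ∦-by-source (λ ()) (λ ()) ∷ []) ∷ (∦-by-source (λ ()) (λ ()) ∷ []) ∷ [] ∷ []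
mbEdges-simple (suc m) = AllPairs.++⁺
  (Simple-map inj₁-injective (mbEdges-simple m))
  ((s-bridge∦t-bridge ∷ All.map⁺ (universal bridge∦inj₂ (mbEdges m)))
    ∷ All.map⁺ (universal bridge∦inj₂ (mbEdges m))
    ∷ Simple-map inj₂-injective (mbEdges-simple m))
  (All.map⁺ (universal (λ e → inj₁∦bridge e ∷ inj₁∦bridge e ∷ All.map⁺ (universal (inj₁∦inj₂ e) (mbEdges m)))
                       (mbEdges m)))
  where
  s-bridge∦t-bridge : ¬ Parallel (inj₂ (MBs m) , inj₁ (MBs m)) (inj₂ (MBt m) , inj₁ (MBt m))
  s-bridge∦t-bridge (inj₁ (s≡t , _)) = MBs≢MBt m (inj₂-injective s≡t)
  s-bridge∦t-bridge (inj₂ (() , _))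

-- In MB_{m+3}, nothing is s₁ and just (inj₁ nothing) is t₂; just (inj₁ (just i)) and just (inj₂ i)
-- are the inner vertices of C₂ and C₁.
Inner : ℕ → Set
Inner zero    = Fin 2
Inner (suc m) = Maybe (Maybe (Inner m) ⊎ Inner m)

inC₁ inC₂ : ∀ {m} → Fin 2 ⊎ Inner m → Fin 2 ⊎ Inner (suc m)
inC₁ (inj₁ zero)       = inj₂ nothing
inC₁ (inj₁ (suc zero)) = inj₁ (suc zero)
inC₁ (inj₂ i)          = inj₂ (just (inj₂ i))
inC₂ (inj₁ zero)       = inj₁ zero
inC₂ (inj₁ (suc zero)) = inj₂ (just (inj₁ nothing))
inC₂ (inj₂ i)          = inj₂ (just (inj₁ (just i)))

label : ∀ m → MBV m → Fin 2 ⊎ Inner m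
label zero    zero                   = inj₁ zero
label zero    (suc zero)             = inj₂ zero
label zero    (suc (suc zero))       = inj₂ (suc zero)
label zero    (suc (suc (suc zero))) = inj₁ (suc zero)
label (suc m) = [ inC₁ ∘ label m , inC₂ ∘ label m ]

unlabel : ∀ m → Fin 2 ⊎ Inner m → MBV m
unlabel m       (inj₁ zero)                  = MBs m
unlabel m       (inj₁ (suc zero))            = MBt m
unlabel zero    (inj₂ zero)                  = suc zero
unlabel zero    (inj₂ (suc zero))            = suc (suc zero)
unlabel (suc m) (inj₂ nothing)               = inj₁ (MBs m)
unlabel (suc m) (inj₂ (just (inj₁ nothing))) = inj₂ (MBt m)
unlabel (suc m) (inj₂ (just (inj₁ (just i)))) = inj₂ (unlabel m (inj₂ i))
unlabel (suc m) (inj₂ (just (inj₂ i)))       = inj₁ (unlabel m (inj₂ i))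

label-MBs : ∀ m → label m (MBs m) ≡ inj₁ zero
label-MBs zero    = refl
label-MBs (suc m) = cong inC₂ (label-MBs m)

label-MBt : ∀ m → label m (MBt m) ≡ inj₁ (suc zero)
label-MBt zero    = refl
label-MBt (suc m) = cong inC₁ (label-MBt m)

unlabel-inC₁ : ∀ m r → unlabel (suc m) (inC₁ r) ≡ inj₁ (unlabel m r)
unlabel-inC₁ m (inj₁ zero)       = refl
unlabel-inC₁ m (inj₁ (suc zero)) = refl
unlabel-inC₁ m (inj₂ i)          = refl

unlabel-inC₂ : ∀ m r → unlabel (suc m) (inC₂ r) ≡ inj₂ (unlabel m r)
unlabel-inC₂ m (inj₁ zero)       = refl
unlabel-inC₂ m (inj₁ (suc zero)) = refl
unlabel-inC₂ m (inj₂ i)          = refl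

unlabel-label : ∀ m v → unlabel m (label m v) ≡ v
unlabel-label zero    zero                   = refl
unlabel-label zero    (suc zero)             = refl
unlabel-label zero    (suc (suc zero))       = refl
unlabel-label zero    (suc (suc (suc zero))) = refl
unlabel-label (suc m) (inj₁ v) = trans (unlabel-inC₁ m (label m v)) (cong inj₁ (unlabel-label m v))
unlabel-label (suc m) (inj₂ v) = trans (unlabel-inC₂ m (label m v)) (cong inj₂ (unlabel-label m v))

label-unlabel : ∀ m r → label m (unlabel m r) ≡ r
label-unlabel m       (inj₁ zero)                   = label-MBs m
label-unlabel m       (inj₁ (suc zero))             = label-MBt m
label-unlabel zero    (inj₂ zero)                   = refl
label-unlabel zero    (inj₂ (suc zero))             = refl
label-unlabel (suc m) (inj₂ nothing)                = cong inC₁ (label-MBs m)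
label-unlabel (suc m) (inj₂ (just (inj₁ nothing)))  = cong inC₂ (label-MBt m)
label-unlabel (suc m) (inj₂ (just (inj₁ (just i)))) = cong inC₂ (label-unlabel m (inj₂ i))
label-unlabel (suc m) (inj₂ (just (inj₂ i)))        = cong inC₁ (label-unlabel m (inj₂ i))

MBV↔Fin2⊎Inner : ∀ m → MBV m ↔ (Fin 2 ⊎ Inner m)
MBV↔Fin2⊎Inner m = mk↔ₛ′ (label m) (unlabel m) (label-unlabel m) (unlabel-label m)

plug : ∀ {m} → V → V → Fin 2 ⊎ Inner m → V ⊎ Inner m
plug x y = map₁ λ { zero → x ; (suc zero) → y }

embed : ∀ m → V → V → MBV m → V ⊎ Inner m
embed m x y = plug x y ∘ label m

Maybe²↔⊎Fin2 : Maybe (Maybe V) ↔ (V ⊎ Fin 2)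
Maybe²↔⊎Fin2 = mk↔ₛ′ to from to-from from-to
  where
  to : Maybe (Maybe V) → V ⊎ Fin 2
  to nothing         = inj₂ zero
  to (just nothing)  = inj₂ (suc zero)
  to (just (just v)) = inj₁ v
  from : V ⊎ Fin 2 → Maybe (Maybe V)
  from (inj₁ v)          = just (just v)
  from (inj₂ zero)       = nothing
  from (inj₂ (suc zero)) = just nothing
  to-from : ∀ w → to (from w) ≡ w
  to-from (inj₁ v)          = refl
  to-from (inj₂ zero)       = refl
  to-from (inj₂ (suc zero)) = refl
  from-to : ∀ w → from (to w) ≡ w
  from-to nothing         = refl
  from-to (just nothing)  = refl
  from-to (just (just v)) = refl

module _ {V : Set} (m : ℕ) where
  reassoc : Maybe (Maybe V ⊎ Inner m) ⊎ Inner m → V ⊎ Inner (suc m)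
  reassoc (inj₁ nothing)                   = inj₂ nothing
  reassoc (inj₁ (just (inj₁ nothing)))     = inj₂ (just (inj₁ nothing))
  reassoc (inj₁ (just (inj₁ (just v))))    = inj₁ v
  reassoc (inj₁ (just (inj₂ i)))           = inj₂ (just (inj₁ (just i)))
  reassoc (inj₂ i)                         = inj₂ (just (inj₂ i))

  unreassoc : V ⊎ Inner (suc m) → Maybe (Maybe V ⊎ Inner m) ⊎ Inner m
  unreassoc (inj₁ v)                       = inj₁ (just (inj₁ (just v)))
  unreassoc (inj₂ nothing)                 = inj₁ nothing
  unreassoc (inj₂ (just (inj₁ nothing)))   = inj₁ (just (inj₁ nothing))
  unreassoc (inj₂ (just (inj₁ (just i))))  = inj₁ (just (inj₂ i))
  unreassoc (inj₂ (just (inj₂ i)))         = inj₂ i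

  reassoc↔ : (Maybe (Maybe V ⊎ Inner m) ⊎ Inner m) ↔ (V ⊎ Inner (suc m))
  reassoc↔ = mk↔ₛ′ reassoc unreassoc reassoc-unreassoc unreassoc-reassoc
    where
    reassoc-unreassoc : ∀ w → reassoc (unreassoc w) ≡ w
    reassoc-unreassoc (inj₁ v)                      = refl
    reassoc-unreassoc (inj₂ nothing)                = refl
    reassoc-unreassoc (inj₂ (just (inj₁ nothing)))  = refl
    reassoc-unreassoc (inj₂ (just (inj₁ (just i)))) = refl
    reassoc-unreassoc (inj₂ (just (inj₂ i)))        = refl
    unreassoc-reassoc : ∀ w → unreassoc (reassoc w) ≡ w
    unreassoc-reassoc (inj₁ nothing)                = refl
    unreassoc-reassoc (inj₁ (just (inj₁ nothing)))  = refl
    unreassoc-reassoc (inj₁ (just (inj₁ (just v)))) = refl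
    unreassoc-reassoc (inj₁ (just (inj₂ i)))        = refl
    unreassoc-reassoc (inj₂ i)                      = refl

  reassoc-C₁ : ∀ (x y : V) r → reassoc (plug nothing (just (inj₁ (just y))) r) ≡ plug x y (inC₁ r)
  reassoc-C₁ x y (inj₁ zero)       = refl
  reassoc-C₁ x y (inj₁ (suc zero)) = refl
  reassoc-C₁ x y (inj₂ i)          = refl

  reassoc-C₂ : ∀ (x y : V) r → reassoc (inj₁ (just (plug (just x) nothing r))) ≡ plug x y (inC₂ r)
  reassoc-C₂ x y (inj₁ zero)       = refl
  reassoc-C₂ x y (inj₁ (suc zero)) = refl
  reassoc-C₂ x y (inj₂ i)          = refl

replaceByMB : ∀ m {V} {x y : V} {es} → SP V ((x , y) ∷ es) →
              SP (V ⊎ Inner m) (map (mapEdge (embed m x y)) (mbEdges m) ++ map (mapEdge inj₁) es)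
replaceByMB zero {es = es} d =
  subst (λ tail → SP _ (_ ∷ _ ∷ _ ∷ tail))
        (trans (sym (map-∘ (map (mapEdge just) es))) (sym (map-∘ es)))
        (relabel Maybe²↔⊎Fin2 (series (series d)))
replaceByMB (suc m) {V} {x} {y} {es} d =
  subst (SP (V ⊎ Inner (suc m))) edges-match (relabel (reassoc↔ m) (replaceByMB m (perm d₃ (swap _ _ ↭-refl))))
  where
  W₁ W₂ : Set
  W₁ = Maybe V ⊎ Inner m
  W₂ = Maybe W₁ ⊎ Inner m

  -- z = nothing : Maybe V becomes t₂, and w = nothing : Maybe W₁ becomes s₁.
  C₂ : Edges W₁
  C₂ = map (mapEdge (embed m (just x) nothing)) (mbEdges m)
  C₁ : Edges W₂
  C₁ = map (mapEdge (embed m nothing (just (inj₁ (just y))))) (mbEdges m)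
  zy xy : W₁ × W₁
  zy = inj₁ nothing , inj₁ (just y)
  xy = inj₁ (just x) , inj₁ (just y)
  rest : Edges W₁
  rest = map (mapEdge inj₁) (map (mapEdge just) es)
  d₃ : SP (Maybe W₁) ((just (inj₁ (just x)) , nothing) ∷ (nothing , just (inj₁ (just y))) ∷ map (mapEdge just) (zy ∷ C₂ ++ rest))
  d₃ = series (perm (replaceByMB m (series (parallel d)))
                    (↭-trans (Perm.shifts C₂ (zy ∷ xy ∷ [])) (swap zy xy ↭-refl)))

  F : W₂ × W₂ → (V ⊎ Inner (suc m)) × (V ⊎ Inner (suc m))
  F = mapEdge (reassoc m)
  ε : MBV (suc m) × MBV (suc m) → (V ⊎ Inner (suc m)) × (V ⊎ Inner (suc m))
  ε = mapEdge (embed (suc m) x y)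
  Z : Edges (V ⊎ Inner (suc m))
  Z = map (mapEdge inj₁) es
  s-bridge t-bridge : MBV (suc m) × MBV (suc m)
  s-bridge = inj₂ (MBs m) , inj₁ (MBs m)
  t-bridge = inj₂ (MBt m) , inj₁ (MBt m)

  C₁-match : map F C₁ ≡ map ε (map (mapEdge inj₁) (mbEdges m))
  C₁-match = trans (map-mapEdge-∘ (λ v → reassoc-C₁ m x y (label m v)) (mbEdges m)) (map-∘ (mbEdges m))
  C₂-match : map (F ∘ mapEdge (inj₁ ∘ just)) C₂ ≡ map ε (map (mapEdge inj₂) (mbEdges m))
  C₂-match = trans (map-mapEdge-∘ (λ v → reassoc-C₂ m x y (label m v)) (mbEdges m)) (map-∘ (mbEdges m))
  s-bridge-match : (inj₁ x , inj₂ nothing) ≡ ε s-bridge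
  s-bridge-match = sym (cong₂ _,_ (cong (plug x y ∘ inC₂) (label-MBs m)) (cong (plug x y ∘ inC₁) (label-MBs m)))
  t-bridge-match : (inj₂ (just (inj₁ nothing)) , inj₁ y) ≡ ε t-bridge
  t-bridge-match = sym (cong₂ _,_ (cong (plug x y ∘ inC₂) (label-MBt m)) (cong (plug x y ∘ inC₁) (label-MBt m)))

  open ≡-Reasoning

  tail-match : map F (map (mapEdge inj₁) (map (mapEdge just) (C₂ ++ rest))) ≡ map ε (map (mapEdge inj₂) (mbEdges m)) ++ Z
  tail-match = begin
      map F (map (mapEdge inj₁) (map (mapEdge just) (C₂ ++ rest)))
    ≡⟨ trans (map-mapEdge-∘ (λ _ → refl) (map (mapEdge just) (C₂ ++ rest))) (map-mapEdge-∘ (λ _ → refl) (C₂ ++ rest)) ⟩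
      map (F ∘ mapEdge (inj₁ ∘ just)) (C₂ ++ rest)
    ≡⟨ map-++ (F ∘ mapEdge (inj₁ ∘ just)) C₂ rest ⟩
      map (F ∘ mapEdge (inj₁ ∘ just)) C₂ ++ map (F ∘ mapEdge (inj₁ ∘ just)) rest
    ≡⟨ cong₂ _++_ C₂-match (trans (map-mapEdge-∘ (λ _ → refl) _) (map-mapEdge-∘ (λ _ → refl) es)) ⟩
      map ε (map (mapEdge inj₂) (mbEdges m)) ++ Z
    ∎

  edges-match : map F (C₁ ++ map (mapEdge inj₁) ((just (inj₁ (just x)) , nothing) ∷ map (mapEdge just) (zy ∷ C₂ ++ rest)))
              ≡ map ε (mbEdges (suc m)) ++ Z
  edges-match = begin
      map F (C₁ ++ map (mapEdge inj₁) ((just (inj₁ (just x)) , nothing) ∷ map (mapEdge just) (zy ∷ C₂ ++ rest)))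
    ≡⟨ map-++ F C₁ _ ⟩
      map F C₁ ++ (inj₁ x , inj₂ nothing) ∷ (inj₂ (just (inj₁ nothing)) , inj₁ y)
        ∷ map F (map (mapEdge inj₁) (map (mapEdge just) (C₂ ++ rest)))
    ≡⟨ cong₂ _++_ C₁-match (cong₂ _∷_ s-bridge-match (cong₂ _∷_ t-bridge-match tail-match)) ⟩
      map ε (map (mapEdge inj₁) (mbEdges m)) ++ ε s-bridge ∷ ε t-bridge ∷ (map ε (map (mapEdge inj₂) (mbEdges m)) ++ Z)
    ≡⟨ ++-assoc (map ε (map (mapEdge inj₁) (mbEdges m))) _ Z ⟨
      (map ε (map (mapEdge inj₁) (mbEdges m)) ++ map ε (s-bridge ∷ t-bridge ∷ map (mapEdge inj₂) (mbEdges m))) ++ Z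
    ≡⟨ cong (_++ Z) (map-++ ε (map (mapEdge inj₁) (mbEdges m)) _) ⟨
      map ε (mbEdges (suc m)) ++ Z
    ∎

plug-terminals : ∀ {m} (r : Fin 2 ⊎ Inner m) → plug zero (suc zero) r ≡ r
plug-terminals (inj₁ zero)       = refl
plug-terminals (inj₁ (suc zero)) = refl
plug-terminals (inj₂ i)          = refl

mbEdges-SP : ∀ m → SP (MBV m) (mbEdges m)
mbEdges-SP m = subst (SP (MBV m)) edges-match (relabel (↔-sym (MBV↔Fin2⊎Inner m)) (replaceByMB m K₂))
  where
  unlabel-embed : ∀ v → unlabel m (embed m zero (suc zero) v) ≡ v
  unlabel-embed v = trans (cong (unlabel m) (plug-terminals (label m v))) (unlabel-label m v)
  edges-match : map (mapEdge (unlabel m)) (map (mapEdge (embed m zero (suc zero))) (mbEdges m) ++ []) ≡ mbEdges m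
  edges-match = trans (cong (map (mapEdge (unlabel m))) (++-identityʳ _))
                      (trans (map-mapEdge-∘ unlabel-embed (mbEdges m)) (map-id (mbEdges m)))

theorem1 : (k : ℕ) → 2 ≤ k → IsSeriesParallel (MBV (k ∸ 2)) (MBAdj (k ∸ 2))
theorem1 (suc (suc m)) (s≤s (s≤s z≤n)) =
  isSeriesParallel (mbEdges-SP m) (mbEdges-simple m) (MBAdj⇔mbEdges m)
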